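{- Let $G$ be a connected graph of order $n$. If $G\in\mathcal{G}_1\cup\mathcal{G}_2$, then $rx_4(G)=n-1$.
   Context: $\mathcal{G}_1$ is the set of graphs obtained from $K_4$ by identifying each vertex of $K_4$ with an end-vertex of an arbitrary path (the four paths being vertex-disjoint otherwise). $\mathcal{G}_2$ is the set of graphs obtained from $K_4-e$ ($K_4$ minus one edge) by identifying each vertex of $K_4-e$ with the root of an arbitrary tree (the four trees being vertex-disjoint otherwise). For a connected graph $G$, an edge-coloring $c:E(G)\to\{1,\dots,q\}$ (adjacent edges may get the same color) is a $4$-rainbow coloring if for every set $S$ of $4$ vertices there is a tree in $G$ containing $S$ whose edges have pairwise distinct colors. $rx_4(G)$ is the minimum $q$ for which such a coloring exists. -}

module Defs where

open import Data.Nat using (ℕ; zero; suc; _≤_; _<_; _∸_)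
open import Data.Fin using (Fin; zero; suc; toℕ; inject₁)
open import Data.Product using (Σ; ∃; ∃-syntax; _×_; _,_)
open import Data.Sum using (_⊎_)
open import Data.List using (List; []; _∷_; map)
open import Data.List.Membership.Propositional using (_∈_; _∉_)
open import Data.List.Relation.Unary.AllPairs using (AllPairs)
open import Relation.Nullary using (¬_)
open import Relation.Binary.PropositionalEquality using (_≡_; _≢_)
open import Relation.Binary.Construct.Closure.ReflexiveTransitive using (Star)
open import Function.Bundles using (_↔_; _⇔_; Inverse)

record Graph (n : ℕ) : Set₁ where
  field
    Adj     : Fin n → Fin n → Set
    sym     : ∀ {u v} → Adj u v → Adj v u
    irrefl  : ∀ {u} → ¬ Adj u u

open Graph public

Connected : ∀ {n} → Graph n → Set
Connected G = ∀ x y → Star (Adj G) x y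

data TreeIn {n} (G : Graph n) : List (Fin n) → List (Fin n × Fin n) → Set where
  single : ∀ v → TreeIn G (v ∷ []) []
  grow   : ∀ {V E} u w → u ∈ V → w ∉ V → Adj G u w →
           TreeIn G V E → TreeIn G (w ∷ V) ((u , w) ∷ E)

-- Edge colourings with colours Fin q (= {1,…,q}); an edge colouring is
-- given as a symmetric function on vertex pairs (only values on edges matter).

record EdgeColouring {n} (G : Graph n) (q : ℕ) : Set where
  field
    col    : Fin n → Fin n → Fin q
    colSym : ∀ u v → col u v ≡ col v u

open EdgeColouring public

Rainbow : ∀ {n q} {G : Graph n} → EdgeColouring G q → List (Fin n × Fin n) → Set
Rainbow c E = AllPairs _≢_ (map (λ e → col c (Data.Product.proj₁ e) (Data.Product.proj₂ e)) E)

Is4Rainbow : ∀ {n q} {G : Graph n} → EdgeColouring G q → Set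
Is4Rainbow {n} {q} {G} c =
  ∀ (a b x y : Fin n) → a ≢ b → a ≢ x → a ≢ y → b ≢ x → b ≢ y → x ≢ y →
  ∃[ V ] ∃[ E ] (TreeIn G V E × a ∈ V × b ∈ V × x ∈ V × y ∈ V × Rainbow c E)

Has4RainbowColouring : ∀ {n} → Graph n → ℕ → Set
Has4RainbowColouring G q = Σ (EdgeColouring G q) Is4Rainbow

Rx4≡ : ∀ {n} → Graph n → ℕ → Set
Rx4≡ G k = Has4RainbowColouring G k × (∀ q → q < k → ¬ Has4RainbowColouring G q)

-- Rooted trees (up to isomorphism): vertices 0,1,…,size of Fin (suc size),
-- root 0, and vertex (suc k) has parent `parent k` with label ≤ k.
-- Every finite rooted tree has such a labelling (e.g. BFS order).

record RTree : Set where
  field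
    size      : ℕ
    parent    : Fin size → Fin (suc size)
    parent-ok : ∀ k → toℕ (parent k) ≤ toℕ k

PathTree : ℕ → RTree
PathTree m = record { size = m ; parent = inject₁ ; parent-ok = λ k → Data.Nat.Properties.≤-reflexive (Data.Fin.Properties.toℕ-inject₁ k) }
  where import Data.Nat.Properties
        import Data.Fin.Properties

-- graph obtained from a base graph B on Fin 4 by identifying vertex i
-- with the root of the rooted tree T i (trees otherwise disjoint)
AttVertex : (Fin 4 → RTree) → Set
AttVertex T = Σ (Fin 4) (λ i → Fin (suc (RTree.size (T i))))

data AttAdj (B : Fin 4 → Fin 4 → Set) (T : Fin 4 → RTree) : AttVertex T → AttVertex T → Set where
  base   : ∀ {i j} → B i j → AttAdj B T (i , zero) (j , zero)
  toPar  : ∀ i k → AttAdj B T (i , suc k) (i , RTree.parent (T i) k)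
  fromPar : ∀ i k → AttAdj B T (i , RTree.parent (T i) k) (i , suc k)

K4Adj : Fin 4 → Fin 4 → Set
K4Adj i j = i ≢ j

K4eAdj : Fin 4 → Fin 4 → Set
K4eAdj i j = i ≢ j × ¬ ((i ≡ suc (suc zero) × j ≡ suc (suc (suc zero)))
                       ⊎ (i ≡ suc (suc (suc zero)) × j ≡ suc (suc zero)))

IsoAtt : ∀ {n} → Graph n → (Fin 4 → Fin 4 → Set) → (Fin 4 → RTree) → Set
IsoAtt {n} G B T =
  Σ (Fin n ↔ AttVertex T) λ f →
    ∀ x y → Adj G x y ⇔ AttAdj B T (Inverse.to f x) (Inverse.to f y)

InG1 : ∀ {n} → Graph n → Set
InG1 G = Σ (Fin 4 → ℕ) λ m → IsoAtt G K4Adj (λ i → PathTree (m i))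

InG2 : ∀ {n} → Graph n → Set
InG2 G = Σ (Fin 4 → RTree) λ T → IsoAtt G K4eAdj T

-- Upper bound: colour a spanning tree with n - 1 distinct colours; any four vertices lie in it.
--
-- Lower bound, for q ≤ n - 2 colours.  Call the n - 4 edges of the attached trees bridges and the
-- vertices of K₄ (or K₄ - e) core vertices.  Two bridges lie in a common rainbow tree (through their
-- lower ends and a core vertex), so bridges get pairwise distinct colours; counting vertices, at
-- most two colours are then used by no bridge ("fresh" colours).  In 𝒢₁ a rainbow tree through the
-- four path ends contains every bridge and three core edges, which would need three fresh colours.
-- In 𝒢₂ every core edge either repeats the colour of a bridge of some branch or carries one of the
-- two fresh colours.  For each of the 6⁵ resulting patterns a table gives at most four vertices
-- (core vertices, or lower ends of bridges whose colour is repeated by a core edge) through which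
-- no rainbow tree passes: bridges forced into the tree exclude the core edges of their colour, two
-- core edges of the same fresh colour exclude each other, and the remaining core edges cannot
-- connect the branches involved.  This last step is a finite computation, checked by evaluation.

module Submission where

open import Defs hiding (sym)
open import Data.Nat using (ℕ; zero; suc; _+_; _∸_; _≤_; _<_; z≤n; s≤s; s<s⁻¹; _≤ᵇ_)
open import Data.Nat.Properties as ℕ using (≤-trans; ≤-refl; ≤-reflexive; <-irrefl; <-asym; <⇒≱; ≤-<-trans; m≤n⇒m≤1+n; m<n⇒m<1+n; +-suc; +-identityʳ; m≤n+m; m≤m+n; m+[n∸m]≡n; ≤ᵇ⇒≤)
open import Data.Fin using (Fin; zero; suc; toℕ; fromℕ; fromℕ<; inject₁)
open import Data.Fin.Properties using (_≟_; all?; any?; injective⇒≤; suc-injective; toℕ-injective; toℕ-fromℕ; toℕ-fromℕ<; toℕ-inject₁; toℕ<n)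
open import Data.Bool using (Bool; true; false; _∧_; _∨_; not; _xor_; T; T?; if_then_else_)
open import Data.Bool.Properties using (T-∧; ∨-comm; ∨-zeroʳ)
open import Data.Bool.ListAction using (all; any)
open import Data.Product using (Σ; ∃; ∃₂; _×_; _,_; proj₁; proj₂)
open import Data.Product.Properties using (≡-dec)
open import Data.Sum using (_⊎_; inj₁; inj₂)
import Data.Sum
open import Data.Empty using (⊥; ⊥-elim)
open import Data.List as List using (List; []; _∷_; map; length; allFin; deduplicate; cartesianProductWith; cartesianProduct; filterᵇ)
open import Data.List.Properties using (length-tabulate; length-deduplicate; length-map; map-cong-local)
open import Data.List.Membership.Propositional using (_∈_; _∉_; find; lose)
open import Data.List.Membership.Propositional.Properties using (∈-lookup; ∈-allFin; ∈-tabulate⁻; ∈-deduplicate⁺; ∈-++⁺ˡ; ∈-map⁺; ∈-map⁻; ∈-filter⁺; ∈-filter⁻; ∈-cartesianProductWith⁺)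
open import Data.List.Membership.Setoid.Properties using (index-injective)
open import Data.List.Relation.Binary.Subset.Propositional using (_⊆_)
open import Data.List.Relation.Unary.Any as Any using (Any; here; there)
open import Data.List.Relation.Unary.Any.Properties using (any⁺; any⁻)
open import Data.List.Relation.Unary.All as All using (All; []; _∷_)
open import Data.List.Relation.Unary.All.Properties using (¬Any⇒All¬; map⁺; map⁻; all⁺; all⁻)
open import Data.List.Relation.Unary.AllPairs using ([]; _∷_)
open import Data.List.Relation.Unary.Unique.Propositional using (Unique)
open import Data.List.Relation.Unary.Unique.Propositional.Properties using (tabulate⁺)
open import Data.List.Relation.Unary.Unique.DecPropositional.Properties using (deduplicate-!)
open import Data.Vec as Vec using (Vec; []; _∷_; lookup; tabulate; replicate)
open import Data.Vec.Properties using (lookup∘tabulate; lookup-replicate; lookup-map)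
open import Function using (_∘_)
open import Function.Bundles using (Inverse; Equivalence)
open import Function.Definitions using (Injective)
open import Relation.Nullary using (¬_; Dec; yes; no; ¬?; does)
open import Relation.Nullary.Decidable using (decidable-stable; dec-true; dec-false; map′; from-yes; isYes; toWitness; toWitnessFalse; fromWitness; _×-dec_; _⊎-dec_; _→-dec_)
open import Relation.Unary using (Decidable)
open import Relation.Binary using (DecidableEquality)
open import Relation.Binary.PropositionalEquality using (_≡_; _≢_; ≢-sym; refl; sym; trans; cong; cong₂; subst; subst₂; setoid)
open import Relation.Binary.Construct.Closure.ReflexiveTransitive using (Star; ε; _◅_)

Unique-lookup-injective : ∀ {A : Set} {xs : List A} → Unique xs → Injective _≡_ _≡_ (List.lookup xs)
Unique-lookup-injective {xs = x ∷ xs} (x∉ ∷ u) {zero} {zero} _ = refl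
Unique-lookup-injective {xs = x ∷ xs} (x∉ ∷ u) {zero} {suc j} eq = ⊥-elim (All.lookup x∉ (∈-lookup j) eq)
Unique-lookup-injective {xs = x ∷ xs} (x∉ ∷ u) {suc i} {zero} eq = ⊥-elim (All.lookup x∉ (∈-lookup i) (sym eq))
Unique-lookup-injective {xs = x ∷ xs} (x∉ ∷ u) {suc i} {suc j} eq = cong suc (Unique-lookup-injective u eq)

Unique-⊆⇒length≤ : ∀ {A : Set} {xs ys : List A} → Unique xs → xs ⊆ ys → length xs ≤ length ys
Unique-⊆⇒length≤ {xs = xs} u xs⊆ys =
  injective⇒≤ λ {i} {j} eq →
    Unique-lookup-injective u (index-injective (setoid _) (xs⊆ys (∈-lookup i)) (xs⊆ys (∈-lookup j)) eq)

Unique⇒length≤ : ∀ {m} {xs : List (Fin m)} → Unique xs → length xs ≤ m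
Unique⇒length≤ {m} u = ≤-trans (Unique-⊆⇒length≤ u λ {x} _ → ∈-allFin x) (≤-reflexive (length-tabulate {n = m} (λ i → i)))

injection⇒≤length : ∀ {A : Set} {k} {g : Fin k → A} {ys : List A} → Injective _≡_ _≡_ g → (∀ i → g i ∈ ys) →
                    k ≤ length ys
injection⇒≤length {g = g} {ys} inj g∈ys =
  ≤-trans (≤-reflexive (sym (length-tabulate g)))
          (Unique-⊆⇒length≤ (tabulate⁺ inj) λ v∈ → let i , v≡gi = ∈-tabulate⁻ v∈ in subst (_∈ ys) (sym v≡gi) (g∈ys i))

length<⇒∃∉ : ∀ {k} (xs : List (Fin k)) → length xs < k → ∃ λ i → i ∉ xs
length<⇒∃∉ xs |xs|<k with any? (λ i → ¬? (Any.any? (i ≟_) xs))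
... | yes i∉ = i∉
... | no none = ⊥-elim (<⇒≱ |xs|<k (injection⇒≤length {g = λ i → i} (λ eq → eq) λ i →
                  decidable-stable (Any.any? (i ≟_) xs) (λ i∉ → none (i , i∉))))

extend-Unique : ∀ {A : Set} → DecidableEquality A → ∀ {k} {g : Fin k → A} → Injective _≡_ _≡_ g →
                ∀ fuel {U} → Unique U → length U + fuel ≡ k → ∃ λ U′ → Unique U′ × length U′ ≡ k × U ⊆ U′
extend-Unique _ _ zero {U} u len = U , u , trans (sym (+-identityʳ _)) len , λ v∈ → v∈
extend-Unique _≟ₐ_ {g = g} inj (suc fuel) {U} u len with any? (λ i → ¬? (Any.any? (g i ≟ₐ_) U))
... | yes (i , gi∉) =
  let U′ , u′ , len′ , U⊆U′ = extend-Unique _≟ₐ_ inj fuel (¬Any⇒All¬ _ gi∉ ∷ u) (trans (sym (+-suc _ fuel)) len)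
  in U′ , u′ , len′ , λ v∈ → U⊆U′ (there v∈)
... | no none = ⊥-elim (<⇒≱ |U|<k (injection⇒≤length inj λ i →
                  decidable-stable (Any.any? (g i ≟ₐ_) U) (λ gi∉ → none (i , gi∉))))
  where |U|<k = ≤-trans (s≤s (m≤m+n (length U) fuel)) (≤-reflexive (trans (sym (+-suc (length U) fuel)) len))

Unique-map⇒≢ : ∀ {A B : Set} {f : A → B} {xs : List A} → Unique (map f xs) →
               ∀ {a b} → a ∈ xs → b ∈ xs → a ≢ b → f a ≢ f b
Unique-map⇒≢ (_ ∷ _) (here refl) (here refl) a≢b = ⊥-elim (a≢b refl)
Unique-map⇒≢ (fx∉ ∷ _) (here refl) (there b∈) _ = All.lookup (map⁻ fx∉) b∈
Unique-map⇒≢ (fx∉ ∷ _) (there a∈) (here refl) _ = λ eq → All.lookup (map⁻ fx∉) a∈ (sym eq)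
Unique-map⇒≢ (_ ∷ u) (there a∈) (there b∈) a≢b = Unique-map⇒≢ u a∈ b∈ a≢b

SameEdge : ∀ {A : Set} → A → A → A → A → Set
SameEdge u w u′ w′ = (u ≡ u′ × w ≡ w′) ⊎ (u ≡ w′ × w ≡ u′)

SameEdge-map : ∀ {A B : Set} (g : A → B) {u w u′ w′} → SameEdge u w u′ w′ → SameEdge (g u) (g w) (g u′) (g w′)
SameEdge-map g = Data.Sum.map (λ (p , q) → cong g p , cong g q) (λ (p , q) → cong g p , cong g q)

SameEdge-map⁻ : ∀ {A B : Set} {g : A → B} → Injective _≡_ _≡_ g →
                ∀ {u w u′ w′} → SameEdge (g u) (g w) (g u′) (g w′) → SameEdge u w u′ w′
SameEdge-map⁻ inj = Data.Sum.map (λ (p , q) → inj p , inj q) (λ (p , q) → inj p , inj q)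

module _ {n : ℕ} (G : Graph n) where
  open import Data.List.Membership.DecPropositional (_≟_ {n}) using (_∈?_)

  EdgeIn : Fin n → Fin n → List (Fin n × Fin n) → Set
  EdgeIn u w E = (u , w) ∈ E ⊎ (w , u) ∈ E

  EdgeIn-resp-SameEdge : ∀ {E u w u′ w′} → SameEdge u w u′ w′ → EdgeIn u w E → EdgeIn u′ w′ E
  EdgeIn-resp-SameEdge (inj₁ (refl , refl)) e∈ = e∈
  EdgeIn-resp-SameEdge (inj₂ (refl , refl)) e∈ = Data.Sum.swap e∈

  rainbow-≢ : ∀ {q} {c : EdgeColouring G q} {E u w u′ w′} → Rainbow c E →
              EdgeIn u w E → EdgeIn u′ w′ E → ¬ SameEdge u w u′ w′ → col c u w ≢ col c u′ w′
  rainbow-≢ rainbow (inj₁ p) (inj₁ p′) ¬same =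
    Unique-map⇒≢ rainbow p p′ λ { refl → ¬same (inj₁ (refl , refl)) }
  rainbow-≢ {c = c} rainbow (inj₁ p) (inj₂ p′) ¬same eq =
    Unique-map⇒≢ rainbow p p′ (λ { refl → ¬same (inj₂ (refl , refl)) }) (trans eq (colSym c _ _))
  rainbow-≢ {c = c} rainbow (inj₂ p) (inj₁ p′) ¬same eq =
    Unique-map⇒≢ rainbow p p′ (λ { refl → ¬same (inj₂ (refl , refl)) }) (trans (colSym c _ _) eq)
  rainbow-≢ {c = c} rainbow (inj₂ p) (inj₂ p′) ¬same eq =
    Unique-map⇒≢ rainbow p p′ (λ { refl → ¬same (inj₁ (refl , refl)) }) (trans (colSym c _ _) (trans eq (colSym c _ _)))

  TreeIn⇒Unique : ∀ {V E} → TreeIn G V E → Unique V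
  TreeIn⇒Unique (single v) = [] ∷ []
  TreeIn⇒Unique (grow u w u∈ w∉ adj t) = ¬Any⇒All¬ _ w∉ ∷ TreeIn⇒Unique t

  TreeIn-edges⊆ : ∀ {V E} → TreeIn G V E → All (λ e → proj₁ e ∈ V × proj₂ e ∈ V) E
  TreeIn-edges⊆ (single v) = []
  TreeIn-edges⊆ (grow u w u∈ w∉ adj t) =
    (there u∈ , here refl) ∷ All.map (λ (x∈ , y∈) → there x∈ , there y∈) (TreeIn-edges⊆ t)

  Crossing : (Fin n → Set) → List (Fin n × Fin n) → Set
  Crossing P E = ∃₂ λ u w → P u × ¬ P w × Adj G u w × EdgeIn u w E

  Crossing-∷ : ∀ {P E e} → Crossing P E → Crossing P (e ∷ E)
  Crossing-∷ (u , w , pu , ¬pw , adj , e∈) = u , w , pu , ¬pw , adj , Data.Sum.map there there e∈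

  tree-crossing : ∀ {V E} → TreeIn G V E → {P : Fin n → Set} → Decidable P →
                  ∀ {x y} → x ∈ V → y ∈ V → P x → ¬ P y → Crossing P E
  tree-crossing (single v) P? (here refl) (here refl) px ¬py = ⊥-elim (¬py px)
  tree-crossing (grow u w u∈ w∉ adj t) P? (here refl) (here refl) px ¬py = ⊥-elim (¬py px)
  tree-crossing (grow u w u∈ w∉ adj t) P? (here refl) (there y∈) pw ¬py with P? u
  ... | yes pu = Crossing-∷ (tree-crossing t P? u∈ y∈ pu ¬py)
  ... | no ¬pu = w , u , pw , ¬pu , Graph.sym G adj , inj₂ (here refl)
  tree-crossing (grow u w u∈ w∉ adj t) P? (there x∈) (here refl) px ¬pw with P? u
  ... | yes pu = u , w , pu , ¬pw , adj , inj₁ (here refl)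
  ... | no ¬pu = Crossing-∷ (tree-crossing t P? x∈ u∈ px ¬pu)
  tree-crossing (grow u w u∈ w∉ adj t) P? (there x∈) (there y∈) px ¬py =
    Crossing-∷ (tree-crossing t P? x∈ y∈ px ¬py)

  exit-edge : ∀ {a b V} → Star (Adj G) a b → a ∈ V → b ∉ V → ∃₂ λ u w → u ∈ V × w ∉ V × Adj G u w
  exit-edge ε a∈ b∉ = ⊥-elim (b∉ a∈)
  exit-edge {V = V} (_◅_ {j = c} adj path) a∈ b∉ with c ∈? V
  ... | yes c∈ = exit-edge path c∈ b∉
  ... | no c∉ = _ , c , a∈ , c∉ , adj

  SpanningTree : Set
  SpanningTree = ∃₂ λ V E → TreeIn G V E × (∀ v → v ∈ V)

  extend-to-spanning : Connected G → ∀ {x₀} fuel {V E} → TreeIn G V E → x₀ ∈ V → n ≤ length V + fuel →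
                       SpanningTree
  extend-to-spanning conn fuel {V} {E} t x₀∈ bound with any? (λ v → ¬? (v ∈? V))
  ... | no none = V , E , t , λ v → decidable-stable (v ∈? V) (λ v∉ → none (v , v∉))
  ... | yes (y , y∉) = grow-by (exit-edge (conn _ y) x₀∈ y∉) fuel bound
    where
    grow-by : (∃₂ λ u w → u ∈ V × w ∉ V × Adj G u w) → ∀ fuel → n ≤ length V + fuel → SpanningTree
    grow-by (u , w , u∈ , w∉ , adj) zero bound =
      ⊥-elim (<⇒≱ (s≤s (≤-trans bound (≤-reflexive (+-identityʳ _)))) (Unique⇒length≤ (TreeIn⇒Unique t′)))
      where t′ = grow u w u∈ w∉ adj t
    grow-by (u , w , u∈ , w∉ , adj) (suc fuel) bound =
      extend-to-spanning conn fuel (grow u w u∈ w∉ adj t) (there x₀∈) (≤-trans bound (≤-reflexive (+-suc _ fuel)))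

  spanning-tree : Connected G → Fin n → SpanningTree
  spanning-tree conn x₀ = extend-to-spanning conn n (single x₀) (here refl) (m≤n+m n 1)

  edgeColour : ∀ {q} → EdgeColouring G q → Fin n × Fin n → Fin q
  edgeColour c (x , y) = col c x y

  recolour : ∀ {q} → EdgeColouring G q → Fin n → Fin q → EdgeColouring G q
  recolour c w new = record
    { col = λ x y → if does (x ≟ w) ∨ does (y ≟ w) then new else col c x y
    ; colSym = λ x y → cong₂ (λ b k → if b then new else k) (∨-comm (does (x ≟ w)) (does (y ≟ w))) (colSym c x y)
    }

  recolour-new : ∀ {q} (c : EdgeColouring G q) w new x → col (recolour c w new) x w ≡ new
  recolour-new c w new x rewrite dec-true (w ≟ w) refl | ∨-zeroʳ (does (x ≟ w)) = refl

  recolour-old : ∀ {q} (c : EdgeColouring G q) {w} new {x y} → x ≢ w → y ≢ w →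
                 col (recolour c w new) x y ≡ col c x y
  recolour-old c {w} new {x} {y} x≢w y≢w rewrite dec-false (x ≟ w) x≢w | dec-false (y ≟ w) y≢w = refl

  -- The edge added to a tree on k vertices gets colour k - 1.
  tree-rainbow-colouring : ∀ {q V E} → TreeIn G V E → length V ≤ suc (suc q) →
                           Σ (EdgeColouring G (suc q)) λ c →
                             Rainbow c E × All (λ e → suc (toℕ (edgeColour c e)) < length V) E
  tree-rainbow-colouring (single v) _ = record { col = λ _ _ → zero ; colSym = λ _ _ → refl } , [] , []
  tree-rainbow-colouring (grow {V = []} u w () w∉ adj t) _
  tree-rainbow-colouring (grow {V = v ∷ V} {E} u w u∈ w∉ adj t) (s≤s bound) =
    let c , rainbow , bounds = tree-rainbow-colouring t (m≤n⇒m≤1+n bound)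
        new = fromℕ< bound
        c′ = recolour c w new
        new-colour = recolour-new c w new u
        unchanged : All (λ e → edgeColour c′ e ≡ edgeColour c e) E
        unchanged = All.map (λ (x∈ , y∈) → recolour-old c new (∈⇒≢w x∈) (∈⇒≢w y∈)) (TreeIn-edges⊆ t)
        new-unused : All (new ≢_) (map (edgeColour c′) E)
        new-unused = map⁺ {f = edgeColour c′} (All.zipWith (λ (eq , b) new≡ →
                      <-irrefl (trans (cong toℕ (sym (trans new≡ eq))) (toℕ-fromℕ< bound)) (s<s⁻¹ b)) (unchanged , bounds))
    in c′ ,
       subst (λ k → All (k ≢_) (map (edgeColour c′) E)) (sym new-colour) new-unused ∷
         subst Unique (sym (map-cong-local unchanged)) rainbow ,
       subst (λ k → suc (toℕ k) < 2 + length V) (sym new-colour) (s≤s (s≤s (≤-reflexive (toℕ-fromℕ< bound)))) ∷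
         All.zipWith (λ (eq , b) → subst (λ k → suc (toℕ k) < 2 + length V) (sym eq) (m<n⇒m<1+n b)) (unchanged , bounds)
    where
    ∈⇒≢w : ∀ {x} → x ∈ v ∷ V → x ≢ w
    ∈⇒≢w x∈ refl = w∉ x∈

  RainbowTreeThrough : ∀ {q} → EdgeColouring G q → List (Fin n) → Set
  RainbowTreeThrough c L = ∃₂ λ V E → TreeIn G V E × L ⊆ V × Rainbow c E

  rainbow-tree-through : ∀ {q} {c : EdgeColouring G q} → Is4Rainbow c →
                         ∀ {g : Fin 4 → Fin n} → Injective _≡_ _≡_ g → ∀ L → length L ≤ 4 → RainbowTreeThrough c L
  rainbow-tree-through rb inj L |L|≤4
    with extend-Unique _≟_ inj (4 ∸ length (deduplicate _≟_ L)) (deduplicate-! _≟_ L)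
           (m+[n∸m]≡n (≤-trans (length-deduplicate _≟_ L) |L|≤4))
  ... | a ∷ b ∷ x ∷ y ∷ [] , ((a≢b ∷ a≢x ∷ a≢y ∷ []) ∷ (b≢x ∷ b≢y ∷ []) ∷ (x≢y ∷ []) ∷ [] ∷ []) , _ , ⊆abxy
    with rb a b x y a≢b a≢x a≢y b≢x b≢y x≢y
  ...   | V , E , t , a∈ , b∈ , x∈ , y∈ , rainbow =
    V , E , t , (λ v∈ → abxy⊆V (⊆abxy (∈-deduplicate⁺ _≟_ v∈))) , rainbow
    where
    abxy⊆V : a ∷ b ∷ x ∷ y ∷ [] ⊆ V
    abxy⊆V (here refl) = a∈
    abxy⊆V (there (here refl)) = b∈
    abxy⊆V (there (there (here refl))) = x∈
    abxy⊆V (there (there (there (here refl)))) = y∈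

rx4-upper : ∀ {m} (G : Graph (suc (suc m))) → Connected G → Has4RainbowColouring G (suc m)
rx4-upper G conn with spanning-tree G conn zero
... | V , E , t , spans with tree-rainbow-colouring G t (Unique⇒length≤ (TreeIn⇒Unique G t))
...   | c , rainbow , _ = c , λ a b x y _ _ _ _ _ _ → V , E , t , spans a , spans b , spans x , spans y , rainbow

-- Graphs obtained by attaching rooted trees to four base vertices

module Attached {n} (G : Graph n) (B : Fin 4 → Fin 4 → Set) (trees : Fin 4 → RTree) (iso : IsoAtt G B trees) where
  open Inverse (proj₁ iso) using (to; from; strictlyInverseˡ; strictlyInverseʳ)

  Vertex : Set
  Vertex = AttVertex trees

  from-injective : Injective _≡_ _≡_ from
  from-injective {a} {b} eq = trans (sym (strictlyInverseˡ a)) (trans (cong to eq) (strictlyInverseˡ b))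

  to⇒from : ∀ {x a} → to x ≡ a → x ≡ from a
  to⇒from {x} refl = sym (strictlyInverseʳ x)

  adj-to : ∀ {x y} → Adj G x y → AttAdj B trees (to x) (to y)
  adj-to {x} {y} = Equivalence.to (proj₂ iso x y)

  _≟ᵥ_ : DecidableEquality Vertex
  a ≟ᵥ b = map′ from-injective (cong from) (from a ≟ from b)

  branch : Vertex → Fin 4
  branch = proj₁

  root : Fin 4 → Vertex
  root i = i , zero

  core : Fin 4 → Fin n
  core i = from (root i)

  core-injective : Injective _≡_ _≡_ core
  core-injective eq = cong proj₁ (from-injective eq)

  four≤n : 4 ≤ n
  four≤n = injective⇒≤ core-injective

  Bridge : Set
  Bridge = Σ (Fin 4) λ i → Fin (RTree.size (trees i))

  child parent : Bridge → Vertex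
  child (i , k) = i , suc k
  parent (i , k) = i , RTree.parent (trees i) k

  depth : Vertex → ℕ
  depth (_ , k) = toℕ k

  parent<child : ∀ β → depth (parent β) < depth (child β)
  parent<child (i , k) = s≤s (RTree.parent-ok (trees i) k)

  child-injective : Injective _≡_ _≡_ child
  child-injective {i , k} refl = refl

  data Below (z : Vertex) : Vertex → Set where
    here : Below z z
    step : ∀ {i} k → Below z (parent (i , k)) → Below z (child (i , k))

  Below-branch : ∀ {z a} → Below z a → branch a ≡ branch z
  Below-branch here = refl
  Below-branch (step k b) = Below-branch b

  root-not-below-child : ∀ β j → ¬ Below (child β) (root j)
  root-not-below-child β j ()

  below? : ∀ z → Decidable (Below z)
  below? z a = below?-within (suc (depth a)) a ≤-refl
    where
    below?-within : ∀ fuel a → depth a < fuel → Dec (Below z a)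
    below?-within (suc fuel) (j , zero) _ with z ≟ᵥ (j , zero)
    ... | yes refl = yes here
    ... | no z≢a = no λ { here → z≢a refl }
    below?-within (suc fuel) (j , suc k) (s≤s bound) with z ≟ᵥ (j , suc k)
    ... | yes refl = yes here
    ... | no z≢a with below?-within fuel (parent (j , k)) (≤-<-trans (RTree.parent-ok (trees j) k) bound)
    ...   | yes b = yes (step k b)
    ...   | no ¬b = no λ { here → z≢a refl ; (step _ b) → ¬b b }

  leaving-subtree : ∀ β {a b} → AttAdj B trees a b → Below (child β) a → ¬ Below (child β) b →
                    a ≡ child β × b ≡ parent β
  leaving-subtree β (base _) a-below _ = ⊥-elim (root-not-below-child β _ a-below)
  leaving-subtree (i , k) (toPar .i .k) here _ = refl , refl
  leaving-subtree β (toPar i k) (step _ b-below) ¬b-below = ⊥-elim (¬b-below b-below)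
  leaving-subtree β (fromPar i k) a-below ¬b-below = ⊥-elim (¬b-below (step k a-below))

  leaving-branch : ∀ {a b} → AttAdj B trees a b → branch a ≢ branch b →
                   ∃₂ λ i j → a ≡ root i × b ≡ root j × B i j
  leaving-branch (base {i} {j} bij) _ = i , j , refl , refl , bij
  leaving-branch (toPar i k) ≢ = ⊥-elim (≢ refl)
  leaving-branch (fromPar i k) ≢ = ⊥-elim (≢ refl)

  bridge-in-tree : ∀ {V E} → TreeIn G V E → ∀ β {x y} → x ∈ V → y ∈ V →
                   Below (child β) (to x) → ¬ Below (child β) (to y) →
                   EdgeIn G (from (child β)) (from (parent β)) E
  bridge-in-tree {E = E} t β x∈ y∈ x-below ¬y-below =
    let u , w , u-below , ¬w-below , adj , uw∈ = tree-crossing G t (λ v → below? (child β) (to v)) x∈ y∈ x-below ¬y-below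
        u≡ , w≡ = leaving-subtree β (adj-to adj) u-below ¬w-below
    in subst₂ (λ u w → EdgeIn G u w E) (to⇒from u≡) (to⇒from w≡) uw∈

  core-edge-in-tree : ∀ {V E} → TreeIn G V E → {P : Fin 4 → Set} → Decidable P → ∀ {x y} → x ∈ V → y ∈ V →
                      P (branch (to x)) → ¬ P (branch (to y)) →
                      ∃₂ λ i j → B i j × EdgeIn G (core i) (core j) E × P i × ¬ P j
  core-edge-in-tree {E = E} t {P} P? x∈ y∈ px ¬py =
    let u , w , pu , ¬pw , adj , uw∈ = tree-crossing G t (λ v → P? (branch (to v))) x∈ y∈ px ¬py
        i , j , u≡ , w≡ , bij = leaving-branch (adj-to adj) (λ eq → ¬pw (subst P eq pu))
    in i , j , bij , subst₂ (λ u w → EdgeIn G u w E) (to⇒from u≡) (to⇒from w≡) uw∈ ,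
       subst P (cong branch u≡) pu , λ pj → ¬pw (subst P (sym (cong branch w≡)) pj)

  to-injective : Injective _≡_ _≡_ to
  to-injective {x} {y} eq = trans (to⇒from eq) (strictlyInverseʳ y)

  child-below-self : ∀ β → Below (child β) (to (from (child β)))
  child-below-self β = subst (Below (child β)) (sym (strictlyInverseˡ (child β))) here

  core-not-below : ∀ β j → ¬ Below (child β) (to (core j))
  core-not-below β j =
    subst (λ a → ¬ Below (child β) a) (sym (strictlyInverseˡ (root j))) (root-not-below-child β j)

  core-≢-child : ∀ i β → core i ≢ from (child β)
  core-≢-child i β eq with from-injective eq
  ... | ()

  module Coloured {q} (c : EdgeColouring G q) (rb : Is4Rainbow c) where

    bridgeColour : Bridge → Fin q
    bridgeColour β = col c (from (child β)) (from (parent β))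

    FreshColour : Fin q → Set
    FreshColour x = ∀ β → bridgeColour β ≢ x

    rainbow-tree : ∀ L → length L ≤ 4 → RainbowTreeThrough G c L
    rainbow-tree = rainbow-tree-through G {c = c} rb {g = core} core-injective

    core-edge-≢-bridge : ∀ {E i j} β → Rainbow c E → EdgeIn G (core i) (core j) E →
                         EdgeIn G (from (child β)) (from (parent β)) E → col c (core i) (core j) ≢ bridgeColour β
    core-edge-≢-bridge {i = i} {j} β rainbow ij∈ β∈ =
      rainbow-≢ G {c = c} rainbow ij∈ β∈
        λ { (inj₁ (eq , _)) → core-≢-child i β eq ; (inj₂ (_ , eq)) → core-≢-child j β eq }

    bridgeColour-injective : Injective _≡_ _≡_ bridgeColour
    bridgeColour-injective {β} {β′} eq with child β ≟ᵥ child β′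
    ... | yes c≡c′ = child-injective c≡c′
    ... | no c≢c′
      with V , E , t , L⊆V , rainbow ← rainbow-tree (from (child β) ∷ from (child β′) ∷ core zero ∷ []) (s≤s (s≤s (s≤s z≤n)))
      = ⊥-elim (rainbow-≢ G {c = c} rainbow (in-tree β (here refl)) (in-tree β′ (there (here refl))) different eq)
      where
      in-tree : ∀ γ → from (child γ) ∈ _ → EdgeIn G (from (child γ)) (from (parent γ)) E
      in-tree γ γ∈ =
        bridge-in-tree t γ (L⊆V γ∈) (L⊆V (there (there (here refl)))) (child-below-self γ) (core-not-below γ zero)
      different : ¬ SameEdge (from (child β)) (from (parent β)) (from (child β′)) (from (parent β′))
      different (inj₁ (eq₁ , _)) = c≢c′ (from-injective eq₁)
      different (inj₂ (eq₁ , eq₂)) =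
        <-asym (subst (λ a → depth a < depth (child β′)) (sym (from-injective eq₁)) (parent<child β′))
               (subst (λ a → depth a < depth (child β)) (from-injective eq₂) (parent<child β))

    three-fresh-colours : ∀ {c₁ c₂ c₃} → c₁ ≢ c₂ → c₁ ≢ c₃ → c₂ ≢ c₃ →
                        FreshColour c₁ → FreshColour c₂ → FreshColour c₃ → n ≤ suc q
    three-fresh-colours {c₁} {c₂} {c₃} c₁≢c₂ c₁≢c₃ c₂≢c₃ new₁ new₂ new₃ =
      injective⇒≤ (λ eq → to-injective (colourOf-injective eq))
      where
      rootColours : List (Fin (suc q))
      rootColours = zero ∷ suc c₁ ∷ suc c₂ ∷ suc c₃ ∷ []
      sucs : ∀ {a b : Fin q} → a ≢ b → suc a ≢ suc b
      sucs a≢b eq = a≢b (suc-injective eq)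
      rootColours-unique : Unique rootColours
      rootColours-unique =
        ((λ ()) ∷ (λ ()) ∷ (λ ()) ∷ []) ∷ (sucs c₁≢c₂ ∷ sucs c₁≢c₃ ∷ []) ∷ (sucs c₂≢c₃ ∷ []) ∷ [] ∷ []
      root-not-bridge : ∀ i β → List.lookup rootColours i ≢ suc (bridgeColour β)
      root-not-bridge zero β ()
      root-not-bridge (suc zero) β eq = new₁ β (sym (suc-injective eq))
      root-not-bridge (suc (suc zero)) β eq = new₂ β (sym (suc-injective eq))
      root-not-bridge (suc (suc (suc zero))) β eq = new₃ β (sym (suc-injective eq))
      colourOf : Vertex → Fin (suc q)
      colourOf (i , zero) = List.lookup rootColours i
      colourOf (i , suc k) = suc (bridgeColour (i , k))
      colourOf-injective : Injective _≡_ _≡_ colourOf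
      colourOf-injective {i , zero} {j , zero} eq = cong root (Unique-lookup-injective rootColours-unique eq)
      colourOf-injective {i , zero} {j , suc l} eq = ⊥-elim (root-not-bridge i (j , l) eq)
      colourOf-injective {i , suc k} {j , zero} eq = ⊥-elim (root-not-bridge j (i , k) (sym eq))
      colourOf-injective {i , suc k} {j , suc l} eq = cong child (bridgeColour-injective (suc-injective eq))

-- 𝒢₁: K₄ with pendant paths

other : Fin 4 → Fin 4
other zero = suc zero
other (suc _) = zero

other-≢ : ∀ i → other i ≢ i
other-≢ zero ()
other-≢ (suc i) ()

module G1-lower {n} (G : Graph n) (m : Fin 4 → ℕ) (iso : IsoAtt G K4Adj (λ i → PathTree (m i))) where
  open Attached G K4Adj (λ i → PathTree (m i)) iso
  open Inverse (proj₁ iso) using (to; from; strictlyInverseˡ)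

  end : Fin 4 → Vertex
  end i = i , fromℕ (m i)

  path-below : ∀ {i} (k : Fin (m i)) (y : Fin (suc (m i))) d → toℕ y ≡ suc (toℕ k + d) →
               Below (child (i , k)) (i , y)
  path-below k y zero eq =
    subst (λ y → Below _ (_ , y)) (toℕ-injective (trans (cong suc (sym (+-identityʳ _))) (sym eq))) here
  path-below k zero (suc d) ()
  path-below k (suc y) (suc d) eq =
    step y (path-below k (inject₁ y) d (trans (toℕ-inject₁ y) (trans (ℕ.suc-injective eq) (+-suc _ d))))

  end-below : ∀ (β : Bridge) → Below (child β) (to (from (end (proj₁ β))))
  end-below (i , k) = subst (Below (child (i , k))) (sym (strictlyInverseˡ (end i)))
    (path-below k (fromℕ (m i)) (m i ∸ suc (toℕ k)) (trans (toℕ-fromℕ (m i)) (sym (m+[n∸m]≡n (toℕ<n k)))))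

  ends : List (Fin n)
  ends = map (from ∘ end) (allFin 4)

  inside-≢-leaving : ∀ {l a b a′ b′} → a ∈ l → b ∈ l → b′ ∉ l → ¬ SameEdge (core a) (core b) (core a′) (core b′)
  inside-≢-leaving {l} a∈ b∈ b′∉ (inj₁ (_ , eq)) = b′∉ (subst (_∈ l) (core-injective eq) b∈)
  inside-≢-leaving {l} a∈ b∈ b′∉ (inj₂ (eq , _)) = b′∉ (subst (_∈ l) (core-injective eq) a∈)

  module _ {q} (c : EdgeColouring G q) (rb : Is4Rainbow c) where
    open Coloured c rb

    module _ {V E} (t : TreeIn G V E) (ends⊆V : ∀ {x} → x ∈ ends → x ∈ V) (rainbow : Rainbow c E) where

      end∈ : ∀ i → from (end i) ∈ V
      end∈ i = ends⊆V (∈-map⁺ (from ∘ end) (∈-allFin i))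

      bridge∈ : ∀ (β : Bridge) → EdgeIn G (from (child β)) (from (parent β)) E
      bridge∈ (i , k) = bridge-in-tree t (i , k) (end∈ i) (end∈ (other i)) (end-below (i , k))
        λ below → other-≢ i (trans (sym (cong branch (strictlyInverseˡ (end (other i))))) (Below-branch below))

      leaving-edge : ∀ l {i k} → i ∈ l → k ∉ l → ∃₂ λ a b → EdgeIn G (core a) (core b) E × a ∈ l × b ∉ l
      leaving-edge l {i} {k} i∈ k∉ =
        let a , b , _ , ab∈ , a∈ , b∉ = core-edge-in-tree t (λ j → Any.any? (j ≟_) l) (end∈ i) (end∈ k)
                                          (subst (_∈ l) (sym (cong branch (strictlyInverseˡ (end i)))) i∈)
                                          (subst (_∉ l) (sym (cong branch (strictlyInverseˡ (end k)))) k∉)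
        in a , b , ab∈ , a∈ , b∉

      fresh-colour : ∀ {a b} → EdgeIn G (core a) (core b) E → FreshColour (col c (core a) (core b))
      fresh-colour ab∈ β eq = core-edge-≢-bridge β rainbow ab∈ (bridge∈ β) (sym eq)

      -- Cutting off {0}, then the ends of the edge found, then these and the next new vertex yields three
      -- distinct core edges of the tree.
      rainbow-tree⇒n≤1+q : n ≤ suc q
      rainbow-tree⇒n≤1+q =
        let k₁ , k₁∉ = length<⇒∃∉ (zero ∷ []) (s≤s (s≤s z≤n))
            a₁ , b₁ , e₁ , a₁∈ , b₁∉ = leaving-edge (zero ∷ []) (here refl) k₁∉
            k₂ , k₂∉ = length<⇒∃∉ (a₁ ∷ b₁ ∷ []) (s≤s (s≤s (s≤s z≤n)))
            a₂ , b₂ , e₂ , a₂∈ , b₂∉ = leaving-edge (a₁ ∷ b₁ ∷ []) (here refl) k₂∉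
            k₃ , k₃∉ = length<⇒∃∉ (a₁ ∷ b₁ ∷ b₂ ∷ []) (s≤s (s≤s (s≤s (s≤s z≤n))))
            a₃ , b₃ , e₃ , a₃∈ , b₃∉ = leaving-edge (a₁ ∷ b₁ ∷ b₂ ∷ []) (here refl) k₃∉
        in three-fresh-colours
             (rainbow-≢ G {c = c} rainbow e₁ e₂ (inside-≢-leaving (here refl) (there (here refl)) b₂∉))
             (rainbow-≢ G {c = c} rainbow e₁ e₃ (inside-≢-leaving (here refl) (there (here refl)) b₃∉))
             (rainbow-≢ G {c = c} rainbow e₂ e₃ (inside-≢-leaving (∈-++⁺ˡ a₂∈) (there (there (here refl))) b₃∉))
             (fresh-colour e₁) (fresh-colour e₂) (fresh-colour e₃)

    n≤1+q : n ≤ suc q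
    n≤1+q = let V , E , t , ends⊆V , rainbow = rainbow-tree ends ≤-refl
            in rainbow-tree⇒n≤1+q t ends⊆V rainbow

  rx4-lower : ∀ q → suc q < n → ¬ Has4RainbowColouring G q
  rx4-lower q sq<n (c , rb) = <⇒≱ sq<n (n≤1+q c rb)

-- 𝒢₂: K₄ - e with pendant trees, a finite case analysis

choices : ∀ {A : Set} {k} → Vec (List A) k → List (Vec A k)
choices [] = [] ∷ []
choices (xs ∷ xss) = cartesianProductWith _∷_ xs (choices xss)

∈-choices : ∀ {A : Set} {k} {xss : Vec (List A) k} {v : Vec A k} → (∀ i → lookup v i ∈ lookup xss i) → v ∈ choices xss
∈-choices {xss = []} {[]} _ = here refl
∈-choices {xss = xs ∷ xss} {x ∷ v} v∈ = ∈-cartesianProductWith⁺ _∷_ (v∈ zero) (∈-choices {xss = xss} (v∈ ∘ suc))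

bools : List Bool
bools = true ∷ false ∷ []

subsetsOf : ∀ {k} → Vec Bool k → List (Vec Bool k)
subsetsOf m = choices (Vec.map (λ b → if b then bools else false ∷ []) m)

∈-subsetsOf : ∀ {k} {M X : Vec Bool k} → (∀ i → T (lookup X i) → T (lookup M i)) → X ∈ subsetsOf M
∈-subsetsOf {M = M} {X} X⊆M =
  ∈-choices {xss = Vec.map (λ b → if b then bools else false ∷ []) M} λ i →
    subst (lookup X i ∈_) (sym (lookup-map i (λ b → if b then bools else false ∷ []) M)) (member (lookup X i) (lookup M i) (X⊆M i))
  where
  member : ∀ x m → (T x → T m) → x ∈ (if m then bools else false ∷ [])
  member true true _ = here refl
  member false true _ = there (here refl)
  member false false _ = here refl
  member true false x⇒m = ⊥-elim (x⇒m _)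

T-not : ∀ b → ¬ T b → T (not b)
T-not true ¬t = ¬t _
T-not false _ = _

T-not⁻ : ∀ b → T (not b) → ¬ T b
T-not⁻ true () _
T-not⁻ false _ ()

T-xor : ∀ a b → T a → ¬ T b → T (a xor b) × T (b xor a)
T-xor true false _ _ = _ , _
T-xor true true _ ¬b = ⊥-elim (¬b _)

pattern v₀ = zero
pattern v₁ = suc zero
pattern v₂ = suc (suc zero)
pattern v₃ = suc (suc (suc zero))

CoreEdge : Set
CoreEdge = Fin 5

pattern e₀₁ = zero
pattern e₀₂ = suc zero
pattern e₀₃ = suc (suc zero)
pattern e₁₂ = suc (suc (suc zero))
pattern e₁₃ = suc (suc (suc (suc zero)))

ends : CoreEdge → Fin 4 × Fin 4
ends e₀₁ = v₀ , v₁
ends e₀₂ = v₀ , v₂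
ends e₀₃ = v₀ , v₃
ends e₁₂ = v₁ , v₂
ends e₁₃ = v₁ , v₃

SameEdge? : ∀ (a b a′ b′ : Fin 4) → Dec (SameEdge a b a′ b′)
SameEdge? a b a′ b′ = ((a ≟ a′) ×-dec (b ≟ b′)) ⊎-dec ((a ≟ b′) ×-dec (b ≟ a′))

K4eAdj? : ∀ i j → Dec (K4eAdj i j)
K4eAdj? i j = ¬? (i ≟ j) ×-dec ¬? (((i ≟ v₂) ×-dec (j ≟ v₃)) ⊎-dec ((i ≟ v₃) ×-dec (j ≟ v₂)))

ends-distinct : ∀ f g → f ≢ g → ¬ SameEdge (proj₁ (ends f)) (proj₂ (ends f)) (proj₁ (ends g)) (proj₂ (ends g))
ends-distinct = from-yes (all? λ f → all? λ g →
  ¬? (f ≟ g) →-dec ¬? (SameEdge? (proj₁ (ends f)) (proj₂ (ends f)) (proj₁ (ends g)) (proj₂ (ends g))))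

edge-of : ∀ i j → K4eAdj i j → ∃ λ f → SameEdge i j (proj₁ (ends f)) (proj₂ (ends f))
edge-of = from-yes (all? λ i → all? λ j → K4eAdj? i j →-dec any? λ f → SameEdge? i j (proj₁ (ends f)) (proj₂ (ends f)))

-- How the colour of a core edge relates to the colouring (made precise by `Class` in `G2-lower`):
-- it is the colour of a bridge of branch j, or a fresh colour, namely a fixed reference fresh
-- colour (fresh₁) or another one (fresh₂).
data Tag : Set where
  fresh₁ fresh₂ : Tag
  bridgeIn : Fin 4 → Tag

tags : List Tag
tags = fresh₁ ∷ fresh₂ ∷ bridgeIn v₀ ∷ bridgeIn v₁ ∷ bridgeIn v₂ ∷ bridgeIn v₃ ∷ []

∈-tags : ∀ t → t ∈ tags
∈-tags fresh₁ = here refl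
∈-tags fresh₂ = there (here refl)
∈-tags (bridgeIn v₀) = there (there (here refl))
∈-tags (bridgeIn v₁) = there (there (there (here refl)))
∈-tags (bridgeIn v₂) = there (there (there (there (here refl))))
∈-tags (bridgeIn v₃) = there (there (there (there (there (here refl)))))

isBridge : Tag → Bool
isBridge (bridgeIn _) = true
isBridge _ = false

tagBranch : Tag → Fin 4
tagBranch (bridgeIn j) = j
tagBranch _ = zero

sameFresh : Tag → Tag → Bool
sameFresh fresh₁ fresh₁ = true
sameFresh fresh₂ fresh₂ = true
sameFresh _ _ = false

Pattern : Set
Pattern = Vec Tag 5

∈-patterns : ∀ d → d ∈ choices (replicate 5 tags)
∈-patterns d = ∈-choices {xss = replicate 5 tags} {v = d} λ i →
  subst (lookup d i ∈_) (sym (lookup-replicate i tags)) (∈-tags (lookup d i))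

-- A vertex through which the tree must pass: the core vertex of a branch, or the lower end of a
-- bridge with the same colour as core edge f (sensible only when f is tagged with a bridge).
data Item : Set where
  rootOf : Fin 4 → Item
  witnessOf : CoreEdge → Item

_==_ : ∀ {k} → Fin k → Fin k → Bool
i == j = isYes (i ≟ j)

isWitnessOf : CoreEdge → Item → Bool
isWitnessOf f (witnessOf g) = f == g
isWitnessOf f (rootOf _) = false

isWitnessOf-≡ : ∀ f s → T (isWitnessOf f s) → s ≡ witnessOf f
isWitnessOf-≡ f (witnessOf g) f==g = cong witnessOf (sym (toWitness f==g))

EdgeSet : Set
EdgeSet = Vec Bool 5

Cut : Set
Cut = Vec Bool 4

crossingEdges : Cut → List CoreEdge
crossingEdges A = filterᵇ (λ f → lookup A (proj₁ (ends f)) xor lookup A (proj₂ (ends f))) (allFin 5)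

crossingEdges⁺ : ∀ (A : Cut) {i j} f → T (lookup A i) → ¬ T (lookup A j) → SameEdge i j (proj₁ (ends f)) (proj₂ (ends f)) →
                 f ∈ crossingEdges A
crossingEdges⁺ A f a ¬b (inj₁ (refl , refl)) =
  ∈-filter⁺ (T? ∘ λ f → lookup A (proj₁ (ends f)) xor lookup A (proj₂ (ends f))) (∈-allFin f) (proj₁ (T-xor _ _ a ¬b))
crossingEdges⁺ A f a ¬b (inj₂ (refl , refl)) =
  ∈-filter⁺ (T? ∘ λ f → lookup A (proj₁ (ends f)) xor lookup A (proj₂ (ends f))) (∈-allFin f) (proj₂ (T-xor _ _ a ¬b))

notBoth : EdgeSet → CoreEdge × CoreEdge → Bool
notBoth X (f , g) = not (lookup X f ∧ lookup X g)

-- X could be the set of core edges of a rainbow tree: it contains no conflicting pair in C and meets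
-- each list in K (the edges crossing a cut that separates the chosen vertices).
Feasible : List (CoreEdge × CoreEdge) → List (List CoreEdge) → EdgeSet → Bool
Feasible C K X = all (notBoth X) C ∧ all (any (lookup X)) K

Feasible⁺ : ∀ {C K X} → (∀ {f g} → (f , g) ∈ C → ¬ (T (lookup X f) × T (lookup X g))) →
            (∀ {ks} → ks ∈ K → Any (T ∘ lookup X) ks) → T (Feasible C K X)
Feasible⁺ {C} {K} {X} conflict-free crossed = Equivalence.from T-∧
  ( all⁻ (notBoth X) {C} (All.tabulate λ {(f , g)} fg∈ → T-not _ λ both → conflict-free fg∈ (Equivalence.to T-∧ both))
  , all⁻ (any (lookup X)) {K} (All.tabulate λ ks∈ → any⁺ (lookup X) (crossed ks∈)) )

noneFeasible : Vec Bool 5 → List (CoreEdge × CoreEdge) → List (List CoreEdge) → Bool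
noneFeasible M C K = all (λ X → not (Feasible C K X)) (subsetsOf M)

module _ (d : Pattern) where

  itemBranch : Item → Fin 4
  itemBranch (rootOf j) = j
  itemBranch (witnessOf f) = tagBranch (lookup d f)

  validItem : Item → Bool
  validItem (rootOf _) = true
  validItem (witnessOf f) = isBridge (lookup d f)

  conflicting : CoreEdge × CoreEdge → Bool
  conflicting (f , g) = not (f == g) ∧ sameFresh (lookup d f) (lookup d g)

  conflicts : List (CoreEdge × CoreEdge)
  conflicts = filterᵇ conflicting (cartesianProduct (allFin 5) (allFin 5))

  conflicts⁻ : ∀ {f g} → (f , g) ∈ conflicts → f ≢ g × T (sameFresh (lookup d f) (lookup d g))
  conflicts⁻ fg∈ =
    let f≢g , same = Equivalence.to T-∧ (proj₂ (∈-filter⁻ (T? ∘ conflicting) {xs = cartesianProduct (allFin 5) (allFin 5)} fg∈))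
    in toWitnessFalse f≢g , same

  module _ (S : List Item) where

    -- f cannot be in the tree: the bridge witnessing f lies between two chosen vertices
    killed : CoreEdge → Bool
    killed f = any (isWitnessOf f) S ∧ any (λ s → not (itemBranch s == tagBranch (lookup d f))) S

    killed⁻ : ∀ {f} → T (killed f) → witnessOf f ∈ S × ∃ λ s → s ∈ S × itemBranch s ≢ tagBranch (lookup d f)
    killed⁻ {f} k =
      let has-witness , elsewhere = Equivalence.to T-∧ k
          s₁ , s₁∈ , is-w = find (any⁻ (isWitnessOf f) S has-witness)
          s₂ , s₂∈ , away = find (any⁻ (λ s → not (itemBranch s == tagBranch (lookup d f))) S elsewhere)
      in subst (_∈ S) (isWitnessOf-≡ f s₁ is-w) s₁∈ , s₂ , s₂∈ , toWitnessFalse away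

    allowed : Vec Bool 5
    allowed = tabulate (not ∘ killed)

    separates : Cut → Bool
    separates A = any (λ s → lookup A (itemBranch s)) S ∧ any (λ s → not (lookup A (itemBranch s))) S

    separates⁻ : ∀ {A} → T (separates A) →
                 (∃ λ s → s ∈ S × T (lookup A (itemBranch s))) × (∃ λ s → s ∈ S × ¬ T (lookup A (itemBranch s)))
    separates⁻ {A} sep =
      let inside , outside = Equivalence.to T-∧ sep
          s₁ , s₁∈ , A-s₁ = find (any⁻ (λ s → lookup A (itemBranch s)) S inside)
          s₂ , s₂∈ , ¬A-s₂ = find (any⁻ (λ s → not (lookup A (itemBranch s))) S outside)
      in (s₁ , s₁∈ , A-s₁) , (s₂ , s₂∈ , T-not⁻ _ ¬A-s₂)

    crossingLists : List (List CoreEdge)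
    crossingLists = map crossingEdges (filterᵇ separates (subsetsOf (replicate 4 true)))

    crossingLists⁻ : ∀ {ks} → ks ∈ crossingLists → ∃ λ A → T (separates A) × ks ≡ crossingEdges A
    crossingLists⁻ ks∈ =
      let A , A∈ , ks≡ = ∈-map⁻ crossingEdges ks∈
      in A , proj₂ (∈-filter⁻ (T? ∘ separates) A∈) , ks≡

    Refutes : Bool
    Refutes = (length S ≤ᵇ 4) ∧ all validItem S ∧ noneFeasible allowed conflicts crossingLists

    Refutes⁻ : T Refutes → length S ≤ 4 × (∀ {s} → s ∈ S → T (validItem s)) ×
               (∀ {X} → X ∈ subsetsOf allowed → ¬ T (Feasible conflicts crossingLists X))
    Refutes⁻ refutes =
      let short , rest = Equivalence.to T-∧ refutes
          valid , none-feasible = Equivalence.to T-∧ rest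
      in ≤ᵇ⇒≤ (length S) 4 short , All.lookup (all⁺ validItem S valid) ,
         λ X∈ → T-not⁻ _ (All.lookup (all⁺ _ _ none-feasible) X∈)

-- Found by a computer search.
templates : List (List Item)
templates =
    (rootOf v₀ ∷ rootOf v₂ ∷ witnessOf e₀₂ ∷ witnessOf e₁₂ ∷ [])
  ∷ (rootOf v₀ ∷ rootOf v₃ ∷ witnessOf e₀₃ ∷ witnessOf e₁₃ ∷ [])
  ∷ (rootOf v₀ ∷ rootOf v₃ ∷ witnessOf e₀₁ ∷ witnessOf e₀₃ ∷ [])
  ∷ (rootOf v₁ ∷ rootOf v₃ ∷ witnessOf e₀₁ ∷ witnessOf e₁₃ ∷ [])
  ∷ (rootOf v₀ ∷ rootOf v₂ ∷ rootOf v₃ ∷ witnessOf e₀₂ ∷ [])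
  ∷ (rootOf v₁ ∷ rootOf v₂ ∷ rootOf v₃ ∷ witnessOf e₁₂ ∷ [])
  ∷ (rootOf v₀ ∷ witnessOf e₀₁ ∷ witnessOf e₀₂ ∷ witnessOf e₀₃ ∷ [])
  ∷ (rootOf v₁ ∷ witnessOf e₀₁ ∷ witnessOf e₁₂ ∷ witnessOf e₁₃ ∷ [])
  ∷ (rootOf v₀ ∷ witnessOf e₀₁ ∷ witnessOf e₀₂ ∷ witnessOf e₁₃ ∷ [])
  ∷ (rootOf v₂ ∷ witnessOf e₀₁ ∷ witnessOf e₀₃ ∷ witnessOf e₁₂ ∷ [])
  ∷ (rootOf v₀ ∷ rootOf v₂ ∷ witnessOf e₀₁ ∷ witnessOf e₀₂ ∷ [])
  ∷ (rootOf v₂ ∷ rootOf v₃ ∷ witnessOf e₀₂ ∷ witnessOf e₁₃ ∷ [])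
  ∷ (rootOf v₂ ∷ rootOf v₃ ∷ witnessOf e₀₃ ∷ witnessOf e₁₂ ∷ [])
  ∷ (rootOf v₁ ∷ rootOf v₂ ∷ witnessOf e₀₁ ∷ witnessOf e₁₂ ∷ [])
  ∷ (rootOf v₀ ∷ rootOf v₂ ∷ rootOf v₃ ∷ witnessOf e₀₃ ∷ [])
  ∷ (rootOf v₁ ∷ rootOf v₂ ∷ rootOf v₃ ∷ witnessOf e₁₃ ∷ [])
  ∷ (rootOf v₁ ∷ rootOf v₃ ∷ witnessOf e₁₂ ∷ witnessOf e₁₃ ∷ [])
  ∷ (rootOf v₀ ∷ rootOf v₃ ∷ witnessOf e₀₂ ∷ witnessOf e₀₃ ∷ [])
  ∷ (rootOf v₁ ∷ rootOf v₂ ∷ rootOf v₃ ∷ witnessOf e₀₁ ∷ [])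
  ∷ (rootOf v₀ ∷ rootOf v₁ ∷ rootOf v₂ ∷ rootOf v₃ ∷ [])
  ∷ (rootOf v₂ ∷ rootOf v₃ ∷ witnessOf e₁₂ ∷ witnessOf e₁₃ ∷ [])
  ∷ (rootOf v₀ ∷ rootOf v₂ ∷ witnessOf e₀₂ ∷ witnessOf e₀₃ ∷ [])
  ∷ (rootOf v₁ ∷ witnessOf e₀₁ ∷ witnessOf e₀₂ ∷ witnessOf e₁₃ ∷ [])
  ∷ (rootOf v₀ ∷ rootOf v₁ ∷ rootOf v₂ ∷ witnessOf e₀₁ ∷ [])
  ∷ (rootOf v₃ ∷ witnessOf e₀₁ ∷ witnessOf e₀₃ ∷ witnessOf e₁₂ ∷ [])
  ∷ (rootOf v₂ ∷ rootOf v₃ ∷ witnessOf e₀₂ ∷ witnessOf e₀₃ ∷ [])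
  ∷ (rootOf v₁ ∷ rootOf v₂ ∷ witnessOf e₁₂ ∷ witnessOf e₁₃ ∷ [])
  ∷ (rootOf v₀ ∷ rootOf v₁ ∷ rootOf v₃ ∷ witnessOf e₀₁ ∷ [])
  ∷ (rootOf v₂ ∷ witnessOf e₀₁ ∷ witnessOf e₁₂ ∷ witnessOf e₁₃ ∷ [])
  ∷ (rootOf v₀ ∷ rootOf v₂ ∷ rootOf v₃ ∷ witnessOf e₀₁ ∷ [])
  ∷ (rootOf v₁ ∷ witnessOf e₀₁ ∷ witnessOf e₀₂ ∷ witnessOf e₀₃ ∷ [])
  ∷ []

certificate : all (λ d → any (Refutes d) templates) (choices (replicate 5 tags)) ≡ true
certificate = refl

-- With p and xs explicit, using the certificate does not make the type checker evaluate it again.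
all-true⇒ : ∀ {A : Set} (p : A → Bool) xs → all p xs ≡ true → ∀ {x} → x ∈ xs → T (p x)
all-true⇒ p xs eq = All.lookup (all⁺ p xs (subst T (sym eq) _))

refutation : ∀ d → ∃ λ S → S ∈ templates × T (Refutes d S)
refutation d =
  find (any⁻ (Refutes d) templates (all-true⇒ (λ d → any (Refutes d) templates) (choices (replicate 5 tags)) certificate (∈-patterns d)))

module G2-lower {n} (G : Graph n) (trees : Fin 4 → RTree) (iso : IsoAtt G K4eAdj trees) where
  open Attached G K4eAdj trees iso
  open Inverse (proj₁ iso) using (to; from; strictlyInverseˡ)

  end₁ end₂ : CoreEdge → Fin n
  end₁ f = core (proj₁ (ends f))
  end₂ f = core (proj₂ (ends f))

  core-edges-≢ : ∀ {f g} → f ≢ g → ¬ SameEdge (end₁ f) (end₂ f) (end₁ g) (end₂ g)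
  core-edges-≢ {f} {g} f≢g same =
    ends-distinct f g f≢g
      (SameEdge-map⁻ core-injective {proj₁ (ends f)} {proj₂ (ends f)} {proj₁ (ends g)} {proj₂ (ends g)} same)

  module _ {q} (c : EdgeColouring G q) (rb : Is4Rainbow c) (sq<n : suc q < n) where
    open Coloured c rb

    coreColour : CoreEdge → Fin q
    coreColour f = col c (end₁ f) (end₂ f)

    FreshColour? : ∀ x → Dec (FreshColour x)
    FreshColour? x =
      map′ (λ h (i , k) → h i k) (λ h i k → h (i , k)) (all? λ i → all? λ k → ¬? (bridgeColour (i , k) ≟ x))

    -- the colour of some core edge not used by any bridge, if there is one
    reference : Σ (Fin q) λ r → ∀ f → FreshColour (coreColour f) → FreshColour r
    reference with any? (λ f → FreshColour? (coreColour f))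
    ... | yes (f , new) = coreColour f , λ _ _ → new
    ... | no none = coreColour zero , λ f new → ⊥-elim (none (f , new))

    r : Fin q
    r = proj₁ reference

    fresh-colours-agree : ∀ {f g} → FreshColour (coreColour f) → FreshColour (coreColour g) →
                          coreColour f ≢ r → coreColour g ≢ r → coreColour f ≡ coreColour g
    fresh-colours-agree {f} {g} fresh-f fresh-g f≢r g≢r =
      decidable-stable (coreColour f ≟ coreColour g) λ f≢g →
        <⇒≱ sq<n (three-fresh-colours (≢-sym f≢r) (≢-sym g≢r) f≢g (proj₂ reference f fresh-f) fresh-f fresh-g)

    data Class (f : CoreEdge) : Tag → Set where
      bridgeIn : ∀ {j} k → bridgeColour (j , k) ≡ coreColour f → Class f (bridgeIn j)
      fresh₁ : FreshColour (coreColour f) → coreColour f ≡ r → Class f fresh₁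
      fresh₂ : FreshColour (coreColour f) → coreColour f ≢ r → Class f fresh₂

    classify : ∀ f → Σ Tag (Class f)
    classify f = by-cases (any? λ j → any? λ k → bridgeColour (j , k) ≟ coreColour f) (coreColour f ≟ r)
      where
      by-cases : Dec (∃₂ λ j k → bridgeColour (j , k) ≡ coreColour f) → Dec (coreColour f ≡ r) → Σ Tag (Class f)
      by-cases (yes (j , k , eq)) _ = bridgeIn j , bridgeIn k eq
      by-cases (no none) (yes f≡r) = fresh₁ , fresh₁ (λ (j , k) eq → none (j , k , eq)) f≡r
      by-cases (no none) (no f≢r) = fresh₂ , fresh₂ (λ (j , k) eq → none (j , k , eq)) f≢r

    colourPattern : Pattern
    colourPattern = tabulate (proj₁ ∘ classify)

    class : ∀ f → Class f (lookup colourPattern f)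
    class f = subst (Class f) (sym (lookup∘tabulate (proj₁ ∘ classify) f)) (proj₂ (classify f))

    sameFresh⇒same-colour : ∀ {f g t u} → Class f t → Class g u → T (sameFresh t u) → coreColour f ≡ coreColour g
    sameFresh⇒same-colour (fresh₁ _ f≡r) (fresh₁ _ g≡r) _ = trans f≡r (sym g≡r)
    sameFresh⇒same-colour {f} {g} (fresh₂ fresh-f f≢r) (fresh₂ fresh-g g≢r) _ =
      fresh-colours-agree {f} {g} fresh-f fresh-g f≢r g≢r

    witnessVertex : ∀ {f t} → Class f t → Fin n
    witnessVertex (bridgeIn {j} k _) = from (child (j , k))
    witnessVertex _ = core zero  -- junk: such items are rejected by validItem

    itemVertex : Item → Fin n
    itemVertex (rootOf j) = core j
    itemVertex (witnessOf f) = witnessVertex (class f)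

    witness-bridge : ∀ f → T (validItem colourPattern (witnessOf f)) →
                     ∃ λ (β : Bridge) → bridgeColour β ≡ coreColour f × itemVertex (witnessOf f) ≡ from (child β) ×
                                        tagBranch (lookup colourPattern f) ≡ proj₁ β
    witness-bridge f = bridge-of (class f)
      where
      bridge-of : ∀ {t} (cl : Class f t) → T (isBridge t) →
                  ∃ λ (β : Bridge) → bridgeColour β ≡ coreColour f × witnessVertex cl ≡ from (child β) ×
                                     tagBranch t ≡ proj₁ β
      bridge-of (bridgeIn k eq) _ = (_ , k) , eq , refl , refl

    itemVertex-branch : ∀ s → T (validItem colourPattern s) → branch (to (itemVertex s)) ≡ itemBranch colourPattern s
    itemVertex-branch (rootOf j) _ = cong branch (strictlyInverseˡ (root j))
    itemVertex-branch (witnessOf f) valid =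
      let β , _ , vertex≡ , branch≡ = witness-bridge f valid
      in trans (cong (branch ∘ to) vertex≡) (trans (cong branch (strictlyInverseˡ (child β))) (sym branch≡))

    module Through (S : List Item) (valid : ∀ {s} → s ∈ S → T (validItem colourPattern s))
                   {V E} (t : TreeIn G V E) (S⊆V : ∀ {x} → x ∈ map itemVertex S → x ∈ V) (rainbow : Rainbow c E) where

      item∈ : ∀ {s} → s ∈ S → itemVertex s ∈ V
      item∈ s∈ = S⊆V (∈-map⁺ itemVertex s∈)

      InTree : CoreEdge → Set
      InTree f = EdgeIn G (end₁ f) (end₂ f) E

      InTree? : ∀ f → Dec (InTree f)
      InTree? f = Any.any? (≡-dec _≟_ _≟_ (end₁ f , end₂ f)) E ⊎-dec
                  Any.any? (≡-dec _≟_ _≟_ (end₂ f , end₁ f)) E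

      treeEdges : EdgeSet
      treeEdges = tabulate (isYes ∘ InTree?)

      treeEdges-sound : ∀ f → T (lookup treeEdges f) → InTree f
      treeEdges-sound f x = toWitness (subst T (lookup∘tabulate (isYes ∘ InTree?) f) x)

      treeEdges-complete : ∀ f → InTree f → T (lookup treeEdges f)
      treeEdges-complete f p = subst T (sym (lookup∘tabulate (isYes ∘ InTree?) f)) (fromWitness p)

      killed⇒absent : ∀ f → T (killed colourPattern S f) → ¬ InTree f
      killed⇒absent f k f∈ =
        let w∈ , s , s∈ , away = killed⁻ colourPattern S k
            β , colour≡ , vertex≡ , branch≡ = witness-bridge f (valid w∈)
            ¬below : ¬ Below (child β) (to (itemVertex s))
            ¬below below = away (trans (sym (itemVertex-branch s (valid s∈))) (trans (Below-branch below) (sym branch≡)))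
            β∈ = bridge-in-tree t β (item∈ w∈) (item∈ s∈)
                   (subst (λ x → Below (child β) (to x)) (sym vertex≡) (child-below-self β)) ¬below
        in core-edge-≢-bridge {i = proj₁ (ends f)} {proj₂ (ends f)} β rainbow f∈ β∈ (sym colour≡)

      conflict-free : ∀ {f g} → (f , g) ∈ conflicts colourPattern → ¬ (T (lookup treeEdges f) × T (lookup treeEdges g))
      conflict-free {f} {g} fg∈ (x-f , x-g) =
        let f≢g , same = conflicts⁻ colourPattern fg∈
        in rainbow-≢ G {c = c} rainbow (treeEdges-sound f x-f) (treeEdges-sound g x-g) (core-edges-≢ f≢g)
             (sameFresh⇒same-colour (class f) (class g) same)

      cut-crossed : ∀ {ks} → ks ∈ crossingLists colourPattern S → Any (T ∘ lookup treeEdges) ks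
      cut-crossed ks∈ =
        let A , sep , ks≡ = crossingLists⁻ colourPattern S ks∈
            (s₁ , s₁∈ , A-s₁) , (s₂ , s₂∈ , ¬A-s₂) = separates⁻ colourPattern S {A} sep
            i , j , adj , ij∈ , A-i , ¬A-j = core-edge-in-tree t (λ i → T? (lookup A i)) (item∈ s₁∈) (item∈ s₂∈)
              (subst (T ∘ lookup A) (sym (itemVertex-branch s₁ (valid s₁∈))) A-s₁)
              (λ a → ¬A-s₂ (subst (T ∘ lookup A) (itemVertex-branch s₂ (valid s₂∈)) a))
            f , same = edge-of i j adj
        in subst (Any (T ∘ lookup treeEdges)) (sym ks≡) (lose (crossingEdges⁺ A f A-i ¬A-j same)
             (treeEdges-complete f (EdgeIn-resp-SameEdge G (SameEdge-map core same) ij∈)))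

      treeEdges-allowed : treeEdges ∈ subsetsOf (allowed colourPattern S)
      treeEdges-allowed = ∈-subsetsOf λ f x →
        subst T (sym (lookup∘tabulate (not ∘ killed colourPattern S) f)) (T-not _ λ k → killed⇒absent f k (treeEdges-sound f x))

      treeEdges-feasible : T (Feasible (conflicts colourPattern) (crossingLists colourPattern S) treeEdges)
      treeEdges-feasible =
        Feasible⁺ {conflicts colourPattern} {crossingLists colourPattern S} {treeEdges} conflict-free cut-crossed

    refuted : ∀ S → T (Refutes colourPattern S) → ⊥
    refuted S refutes =
      let short , valid , infeasible = Refutes⁻ colourPattern S refutes
          V , E , t , S⊆V , rainbow = rainbow-tree (map itemVertex S) (subst (_≤ 4) (sym (length-map itemVertex S)) short)
          open Through S valid t S⊆V rainbow
      in infeasible treeEdges-allowed treeEdges-feasible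

    no-colouring : ⊥
    no-colouring = let S , _ , refutes = refutation colourPattern in refuted S refutes

  rx4-lower : ∀ q → suc q < n → ¬ Has4RainbowColouring G q
  rx4-lower q sq<n (c , rb) = no-colouring c rb sq<n

rx4≡n∸1 : ∀ {n} (G : Graph n) → Connected G → 4 ≤ n → (∀ q → suc q < n → ¬ Has4RainbowColouring G q) →
          Rx4≡ G (n ∸ 1)
rx4≡n∸1 G conn (s≤s (s≤s _)) lower = rx4-upper G conn , λ q q<n∸1 → lower q (s≤s q<n∸1)

lemma3p6 : ∀ {n : ℕ} (G : Graph n) → Connected G →
             InG1 G ⊎ InG2 G → Rx4≡ G (n ∸ 1)
lemma3p6 G conn (inj₁ (m , iso)) =
  rx4≡n∸1 G conn (Attached.four≤n G K4Adj _ iso) (G1-lower.rx4-lower G m iso)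
lemma3p6 G conn (inj₂ (trees , iso)) =
  rx4≡n∸1 G conn (Attached.four≤n G K4eAdj trees iso) (G2-lower.rx4-lower G trees iso)
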